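{- Let $\varphi$ be a normalized $\forall^{\pi}_{0,2}$-conjunction, and let $I=(M_I,\pi_I)$ and $J=(M_J,\pi_J)$ be two interpretations such that (a) $Ix = Jx$ for every set variable $x$, and (b) for all sets $u,v$ in the von Neumann universe $\mathcal{V}$ and every map variable $f$: $\pi_I(u,v)\in If \iff \pi_J(u,v)\in Jf$. Then $I\models\varphi$ if and only if $J\models\varphi$.
   Context: Sets are the pure sets of the von Neumann cumulative hierarchy $\mathcal{V}$ (ZF with regularity). There are two infinite disjoint collections of variables: set variables $x,y,z,\dots$ and map variables $f,g,h,\dots$. A pairing function is a binary operation $\pi$ on $\mathcal{V}$ such that $\pi(u,v)=\pi(u',v')\iff u=u'\wedge v=v'$, and such that for all sets $u,v$ the collection $u\times_\pi v=\{\pi(u',v'):u'\in u, v'\in v\}$ is a set. For a set $s$, the $\pi$-pairs of $s$ are the members of $s$ of the form $\pi(v_1,v_2)$. An interpretation $I=(M_I,\pi_I)$ consists of a pairing function $\pi_I$ and an assignment $M_I$ of sets to variables such that, for every map variable $f$, every member of $M_I f$ is a $\pi_I$-pair. One writes $Ix=M_Ix$ for variables and $I[x,y]=\pi_I(Ix,Iy)$. For a set $W$ of variables, $J$ is a $W$-variant of $I$ if $\pi_J=\pi_I$ and $M_J$ agrees with $M_I$ outside $W$. The language $\forall^{\pi}_{0,2}$: atomic formulae are $x\in y$, $x=y$, $[x,y]\in f$, $f=g$ ($x,y$ set variables, $f,g$ map variables); quantifier-free formulae are propositional combinations of atomic ones. A universal prenex formula has the form $(\forall x_1\in z_1)\cdots(\forall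 x_h\in z_h)(\forall[x_{h+1},y_{h+1}]\in f_{h+1})\cdots(\forall[x_n,y_n]\in f_n)\delta$ with $x_i,y_i,z_i$ set variables, $f_j$ map variables and $\delta$ quantifier-free; the $z_i$ are its domain variables; it is simple if no quantified variable also occurs as a domain variable. Existential prenex formulae are defined analogously with $\exists$. Semantics: atomic formulae have the standard meaning of $\in$ and $=$ with $[x,y]$ interpreted as $\pi_I(Ix,Iy)$; $I\models(\forall x\in z)\psi$ iff $J\models\psi$ for every $\{x\}$-variant $J$ of $I$ with $Jx\in Jz$; $I\models(\forall[x,y]\in f)\psi$ iff $J\models\psi$ for every $\{x,y\}$-variant $J$ of $I$ with $J[x,y]\in Jf$; existential quantifiers are dual. A normalized $\forall^{\pi}_{0,2}$-conjunction is a finite conjunction of simple universal prenex formulae (quantifier-free formulae count as having an empty prefix). -}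

module Defs where

open import Data.Nat using (ℕ; _≟_)
open import Data.Bool using (if_then_else_)
open import Data.List using (List; []; _∷_)
open import Data.List.Relation.Unary.All using (All)
open import Data.Product using (Σ; ∃; _×_; _,_)
open import Data.Sum using (_⊎_)
open import Data.Empty using (⊥)
open import Data.Unit using (⊤)
open import Relation.Nullary using (¬_)
open import Relation.Nullary.Decidable using (⌊_⌋)
open import Relation.Binary.PropositionalEquality using (_≡_; _≢_)
open import Function.Bundles using (_⇔_)
open import Induction.WellFounded using (WellFounded)

SVar : Set
SVar = ℕ

MVar : Set
MVar = ℕ

-- The universe of sets: a carrier with a membership relation;
-- equality of sets is propositional equality.  We require the
-- extensionality and regularity properties of the von Neumann universe.

record Universe : Set₁ where
  field
    V    : Set
    _∈V_ : V → V → Set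
    extensional : ∀ a b → (∀ t → (t ∈V a) ⇔ (t ∈V b)) → a ≡ b
    regular : WellFounded _∈V_

data QF : Set where
  _∈ₛ_   : SVar → SVar → QF
  _=ₛ_   : SVar → SVar → QF
  [_,_]∈_ : SVar → SVar → MVar → QF
  _=ₘ_   : MVar → MVar → QF
  ⊤ᶠ ⊥ᶠ  : QF
  ¬ᶠ_    : QF → QF
  _∧ᶠ_ _∨ᶠ_ _⇒ᶠ_ : QF → QF → QF

-- Universal prenex formula
--   (∀ x₁ ∈ z₁)…(∀ x_h ∈ z_h)(∀ [x_{h+1},y_{h+1}] ∈ f_{h+1})…(∀ [x_n,y_n] ∈ f_n) δ
record UPrenex : Set where
  constructor uprenex
  field
    setQs  : List (SVar × SVar)
    pairQs : List (SVar × SVar × MVar)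
    matrix : QF

open UPrenex public

data _occursIn_ (v : SVar) : List SVar → Set where
  here  : ∀ {xs} → v occursIn (v ∷ xs)
  there : ∀ {w xs} → v occursIn xs → v occursIn (w ∷ xs)

quantifiedVars : UPrenex → List SVar
quantifiedVars (uprenex sq pq _) = go₁ sq (go₂ pq)
  where
  go₂ : List (SVar × SVar × MVar) → List SVar
  go₂ [] = []
  go₂ ((x , y , _) ∷ ps) = x ∷ y ∷ go₂ ps
  go₁ : List (SVar × SVar) → List SVar → List SVar
  go₁ [] acc = acc
  go₁ ((x , _) ∷ ps) acc = x ∷ go₁ ps acc

domainVars : UPrenex → List SVar
domainVars (uprenex sq _ _) = go sq
  where
  go : List (SVar × SVar) → List SVar
  go [] = []
  go ((_ , z) ∷ ps) = z ∷ go ps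

Simple : UPrenex → Set
Simple φ = ∀ v → v occursIn quantifiedVars φ → ¬ (v occursIn domainVars φ)

record NormConj : Set where
  constructor normConj
  field
    conjuncts : List UPrenex
    simple    : All Simple conjuncts

module _ (U : Universe) where
  open Universe U

  record IsPairing (π : V → V → V) : Set where
    field
      injective : ∀ u v u′ v′ → (π u v ≡ π u′ v′) ⇔ (u ≡ u′ × v ≡ v′)
      product   : ∀ u v → ∃ λ w → ∀ t →
                    (t ∈V w) ⇔ (Σ V λ u′ → Σ V λ v′ →
                                  u′ ∈V u × v′ ∈V v × t ≡ π u′ v′)

  record Interpretation : Set where
    field
      π        : V → V → V
      isPairing : IsPairing π
      setM     : SVar → V
      mapM     : MVar → V
      mapPairs : ∀ f t → t ∈V mapM f → Σ V λ u → Σ V λ v → t ≡ π u v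

  update : (SVar → V) → SVar → V → (SVar → V)
  update σ x u w = if ⌊ w ≟ x ⌋ then u else σ w

  module _ (I : Interpretation) where
    open Interpretation I

    ⟦_⟧qf : QF → (SVar → V) → Set
    ⟦ x ∈ₛ y ⟧qf σ = σ x ∈V σ y
    ⟦ x =ₛ y ⟧qf σ = σ x ≡ σ y
    ⟦ [ x , y ]∈ f ⟧qf σ = π (σ x) (σ y) ∈V mapM f
    ⟦ f =ₘ g ⟧qf σ = mapM f ≡ mapM g
    ⟦ ⊤ᶠ ⟧qf σ = ⊤
    ⟦ ⊥ᶠ ⟧qf σ = ⊥
    ⟦ ¬ᶠ δ ⟧qf σ = ¬ ⟦ δ ⟧qf σ
    ⟦ δ ∧ᶠ ε ⟧qf σ = ⟦ δ ⟧qf σ × ⟦ ε ⟧qf σ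
    ⟦ δ ∨ᶠ ε ⟧qf σ = ⟦ δ ⟧qf σ ⊎ ⟦ ε ⟧qf σ
    ⟦ δ ⇒ᶠ ε ⟧qf σ = ⟦ δ ⟧qf σ → ⟦ ε ⟧qf σ

    satPairs : List (SVar × SVar × MVar) → QF → (SVar → V) → Set
    satPairs [] δ σ = ⟦ δ ⟧qf σ
    satPairs ((x , y , f) ∷ ps) δ σ =
      ∀ u v → let σ′ = update (update σ x u) y v in
              π (σ′ x) (σ′ y) ∈V mapM f → satPairs ps δ σ′

    satSets : List (SVar × SVar) → List (SVar × SVar × MVar) → QF →
              (SVar → V) → Set
    satSets [] ps δ σ = satPairs ps δ σ
    satSets ((x , z) ∷ qs) ps δ σ =
      ∀ u → let σ′ = update σ x u in
            σ′ x ∈V σ′ z → satSets qs ps δ σ′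

    satPrenex : UPrenex → Set
    satPrenex (uprenex qs ps δ) = satSets qs ps δ setM

    satList : List UPrenex → Set
    satList [] = ⊤
    satList (φ ∷ φs) = satPrenex φ × satList φs

    _⊨_ : NormConj → Set
    _⊨_ φ = satList (NormConj.conjuncts φ)

-- Under a common assignment of the set variables, I and J agree on every
-- atomic formula: on x ∈ y and x = y trivially, on [x,y] ∈ f by (b), and on
-- f = g because, by extensionality and since maps contain only pairs, If = Ig
-- holds exactly when If and Ig contain the same pairs, which (b) transfers to
-- J.  The bounded quantifiers range over the same values with guards that are
-- atomic formulae, so agreement propagates through every prefix.
module Submission where

open import Defs
open import Data.Bool using (true; false)
open import Data.List using ([]; _∷_)
open import Data.Nat using (_≟_)
open import Data.Product using (_,_)
open import Data.Product.Function.NonDependent.Propositional using (_×-⇔_)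
open import Data.Sum.Function.Propositional using (_⊎-⇔_)
open import Function.Bundles using (_⇔_; mk⇔; Equivalence)
open import Function.Construct.Composition using (_⇔-∘_)
open import Function.Construct.Identity using (⇔-id)
open import Function.Construct.Symmetry using (⇔-sym)
open import Function.Related.TypeIsomorphisms using (→-cong-⇔; ¬-cong-⇔)
open import Relation.Binary.PropositionalEquality using (_≡_; refl; _≗_)
open import Relation.Nullary.Decidable using (⌊_⌋)

open Equivalence using (to; from)

∀-cong-⇔ : ∀ {a p q} {A : Set a} {P : A → Set p} {Q : A → Set q} →
           (∀ x → P x ⇔ Q x) → (∀ x → P x) ⇔ (∀ x → Q x)
∀-cong-⇔ P⇔Q = mk⇔ (λ p x → to (P⇔Q x) (p x)) (λ q x → from (P⇔Q x) (q x))

⇔-cong-⇔ : ∀ {a b c d} {A : Set a} {B : Set b} {C : Set c} {D : Set d} →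
           A ⇔ B → C ⇔ D → (A ⇔ C) ⇔ (B ⇔ D)
⇔-cong-⇔ A⇔B C⇔D =
  mk⇔ (λ A⇔C → C⇔D ⇔-∘ (A⇔C ⇔-∘ ⇔-sym A⇔B))
      (λ B⇔D → ⇔-sym C⇔D ⇔-∘ (B⇔D ⇔-∘ A⇔B))

subst₂-⇔ : ∀ {a b r} {A : Set a} {B : Set b} (R : A → B → Set r) {x x′ y y′} →
           x ≡ x′ → y ≡ y′ → R x y ⇔ R x′ y′
subst₂-⇔ R refl refl = ⇔-id _

module _ (U : Universe) where
  open Universe U
  open Interpretation

  update-cong : ∀ {σ τ : SVar → V} → σ ≗ τ → ∀ x u → update U σ x u ≗ update U τ x u
  update-cong σ≗τ x u w with ⌊ w ≟ x ⌋
  ... | true  = refl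
  ... | false = σ≗τ w

  mapM-≡⇔samePairs : (K : Interpretation U) (f g : MVar) →
                     mapM K f ≡ mapM K g ⇔
                     (∀ u v → π K u v ∈V mapM K f ⇔ π K u v ∈V mapM K g)
  mapM-≡⇔samePairs K f g = mk⇔ ≡⇒samePairs samePairs⇒≡
    where
    ≡⇒samePairs : mapM K f ≡ mapM K g →
                  ∀ u v → π K u v ∈V mapM K f ⇔ π K u v ∈V mapM K g
    ≡⇒samePairs f≡g u v = subst₂-⇔ _∈V_ refl f≡g

    pairs⊆⇒⊆ : ∀ {f g} → (∀ u v → π K u v ∈V mapM K f → π K u v ∈V mapM K g) →
               ∀ t → t ∈V mapM K f → t ∈V mapM K g
    pairs⊆⇒⊆ {f} pairs⊆ t t∈f with mapPairs K f t t∈f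
    ... | u , v , refl = pairs⊆ u v t∈f

    samePairs⇒≡ : (∀ u v → π K u v ∈V mapM K f ⇔ π K u v ∈V mapM K g) →
                  mapM K f ≡ mapM K g
    samePairs⇒≡ same = extensional _ _ λ t →
      mk⇔ (pairs⊆⇒⊆ (λ u v → to (same u v)) t) (pairs⊆⇒⊆ (λ u v → from (same u v)) t)

  module Transfer (I J : Interpretation U)
    (pair⇔ : ∀ u v f → π I u v ∈V mapM I f ⇔ π J u v ∈V mapM J f) where

    mapM-≡-transfer : ∀ f g → mapM I f ≡ mapM I g ⇔ mapM J f ≡ mapM J g
    mapM-≡-transfer f g =
      ⇔-sym (mapM-≡⇔samePairs J f g)
      ⇔-∘ (∀-cong-⇔ (λ u → ∀-cong-⇔ λ v → ⇔-cong-⇔ (pair⇔ u v f) (pair⇔ u v g))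
      ⇔-∘ mapM-≡⇔samePairs I f g)

    pair-transfer : ∀ {σ τ : SVar → V} → σ ≗ τ → ∀ x y f →
                    π I (σ x) (σ y) ∈V mapM I f ⇔ π J (τ x) (τ y) ∈V mapM J f
    pair-transfer σ≗τ x y f =
      subst₂-⇔ (λ a b → π J a b ∈V mapM J f) (σ≗τ x) (σ≗τ y) ⇔-∘ pair⇔ _ _ f

    qf-transfer : ∀ δ {σ τ : SVar → V} → σ ≗ τ → ⟦_⟧qf U I δ σ ⇔ ⟦_⟧qf U J δ τ
    qf-transfer (x ∈ₛ y)       σ≗τ = subst₂-⇔ _∈V_ (σ≗τ x) (σ≗τ y)
    qf-transfer (x =ₛ y)       σ≗τ = subst₂-⇔ _≡_ (σ≗τ x) (σ≗τ y)
    qf-transfer ([ x , y ]∈ f) σ≗τ = pair-transfer σ≗τ x y f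
    qf-transfer (f =ₘ g)       σ≗τ = mapM-≡-transfer f g
    qf-transfer ⊤ᶠ             σ≗τ = ⇔-id _
    qf-transfer ⊥ᶠ             σ≗τ = ⇔-id _
    qf-transfer (¬ᶠ δ)         σ≗τ = ¬-cong-⇔ (qf-transfer δ σ≗τ)
    qf-transfer (δ ∧ᶠ ε)       σ≗τ = qf-transfer δ σ≗τ ×-⇔ qf-transfer ε σ≗τ
    qf-transfer (δ ∨ᶠ ε)       σ≗τ = qf-transfer δ σ≗τ ⊎-⇔ qf-transfer ε σ≗τ
    qf-transfer (δ ⇒ᶠ ε)       σ≗τ = →-cong-⇔ (qf-transfer δ σ≗τ) (qf-transfer ε σ≗τ)

    satPairs-transfer : ∀ ps δ {σ τ : SVar → V} → σ ≗ τ →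
                        satPairs U I ps δ σ ⇔ satPairs U J ps δ τ
    satPairs-transfer []                 δ σ≗τ = qf-transfer δ σ≗τ
    satPairs-transfer ((x , y , f) ∷ ps) δ σ≗τ =
      ∀-cong-⇔ λ u → ∀-cong-⇔ λ v →
        let σ′≗τ′ = update-cong (update-cong σ≗τ x u) y v in
        →-cong-⇔ (pair-transfer σ′≗τ′ x y f) (satPairs-transfer ps δ σ′≗τ′)

    satSets-transfer : ∀ qs ps δ {σ τ : SVar → V} → σ ≗ τ →
                       satSets U I qs ps δ σ ⇔ satSets U J qs ps δ τ
    satSets-transfer []             ps δ σ≗τ = satPairs-transfer ps δ σ≗τ
    satSets-transfer ((x , z) ∷ qs) ps δ σ≗τ =
      ∀-cong-⇔ λ u →
        let σ′≗τ′ = update-cong σ≗τ x u in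
        →-cong-⇔ (subst₂-⇔ _∈V_ (σ′≗τ′ x) (σ′≗τ′ z)) (satSets-transfer qs ps δ σ′≗τ′)

    satList-transfer : ∀ φs → setM I ≗ setM J → satList U I φs ⇔ satList U J φs
    satList-transfer []                     I≗J = ⇔-id _
    satList-transfer (uprenex qs ps δ ∷ φs) I≗J =
      satSets-transfer qs ps δ I≗J ×-⇔ satList-transfer φs I≗J

lemma1 : (U : Universe) → (φ : NormConj) → (I J : Interpretation U) →
    (∀ x → Interpretation.setM I x ≡ Interpretation.setM J x) →
    (∀ u v f → Universe._∈V_ U (Interpretation.π I u v) (Interpretation.mapM I f)
    ⇔ Universe._∈V_ U (Interpretation.π J u v) (Interpretation.mapM J f)) →
    (_⊨_ U I φ ⇔ _⊨_ U J φ)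
lemma1 U φ I J sameSets samePairs =
  Transfer.satList-transfer U I J samePairs (NormConj.conjuncts φ) sameSets
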